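{- Let $M$ be a maximal planar graph or an $n$-semi-MPG with $n\ge 3$. Then every R-tiling $T_r$ of $M$ is grand; that is, $V(M)$ can be partitioned as $V(M)=V_{13}\uplus V_{24}$ such that every black edge of $T_r$ joins a vertex of $V_{13}$ to a vertex of $V_{24}$, and no red edge of $T_r$ joins a vertex of $V_{13}$ to a vertex of $V_{24}$.
   Context: A maximal planar graph (MPG) is a simple plane graph all of whose faces, including the outer one, are triangles. An $n$-semi-MPG is a connected simple plane graph in which every face is a triangle except one designated face, the outer facet, which is an $n$-gon ($n=3$ allowed; a 3-gon outer facet is not treated as a triangular face for tilings). An R-tiling of $M$ is a map $T_r:E(M)\to\{\text{red},\text{black}\}$ such that every triangular face other than the outer facet has exactly one red edge and two black edges. -}

module Defs where

-- Plane graphs are represented combinatorially as (connected) combinatorial maps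
-- (rotation systems) of genus 0:
--   darts  = Fin d (each edge = two darts {x , α x}),
--   σ      = rotation of darts around their vertex (a permutation),
--   vertices = σ-orbits, edges = α-orbits, faces = φ-orbits with φ = σ ∘ α.
-- Genus 0 (embedding in the sphere / plane) is imposed via Euler's formula
--   #vertices − #edges + #faces = 2, i.e. 2·(#V + #F) = d + 4.

open import Data.Nat using (ℕ; zero; suc; _+_; _*_; _<_; _≤_)
open import Data.Fin using (Fin)
open import Data.Bool using (Bool; true; false)
open import Data.Product using (Σ; ∃; _×_; _,_)
open import Data.Sum using (_⊎_)
open import Relation.Binary.PropositionalEquality using (_≡_; _≢_)
open import Relation.Nullary using (¬_)
open import Data.Unit using (⊤)
open import Data.Empty using (⊥)

iter : {A : Set} → (A → A) → ℕ → A → A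
iter f zero    x = x
iter f (suc k) x = f (iter f k x)

SameOrbit : {d : ℕ} → (Fin d → Fin d) → Fin d → Fin d → Set
SameOrbit π x y = ∃ λ k → iter π k x ≡ y

HasOrbitCount : {d : ℕ} → (Fin d → Fin d) → ℕ → Set
HasOrbitCount {d} π n =
  Σ (Fin d → Fin n) λ lab →
    (∀ (v : Fin n) → ∃ λ x → lab x ≡ v) ×
    (∀ x y → (lab x ≡ lab y → SameOrbit π x y) × (SameOrbit π x y → lab x ≡ lab y))

record CombMap : Set where
  field
    d      : ℕ
    α      : Fin d → Fin d
    σ      : Fin d → Fin d
    σ⁻     : Fin d → Fin d
    α-inv  : ∀ x → α (α x) ≡ x
    α-free : ∀ x → α x ≢ x
    σσ⁻    : ∀ x → σ (σ⁻ x) ≡ x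
    σ⁻σ    : ∀ x → σ⁻ (σ x) ≡ x

  φ : Fin d → Fin d
  φ x = σ (α x)

  SameVertex : Fin d → Fin d → Set
  SameVertex = SameOrbit σ

  SameFace : Fin d → Fin d → Set
  SameFace = SameOrbit φ

  FaceSize : Fin d → ℕ → Set
  FaceSize x k = (iter φ k x ≡ x) × (∀ j → 0 < j → j < k → iter φ j x ≢ x)

open CombMap public

data Reach (M : CombMap) : Fin (d M) → Fin (d M) → Set where
  here  : ∀ {x} → Reach M x x
  stepσ : ∀ {x y} → Reach M (σ M x) y → Reach M x y
  stepα : ∀ {x y} → Reach M (α M x) y → Reach M x y

record PlaneSimple (M : CombMap) : Set where
  field
    connected  : ∀ x y → Reach M x y
    no-loop    : ∀ x → ¬ SameVertex M x (α M x)
    no-multi   : ∀ x y → SameVertex M x y → SameVertex M (α M x) (α M y) → x ≡ y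
    euler      : Σ ℕ λ nV → Σ ℕ λ nF →
                   HasOrbitCount (σ M) nV × HasOrbitCount (φ M) nF ×
                   (2 * (nV + nF) ≡ d M + 4)

record MPG (M : CombMap) : Set where
  field
    plane     : PlaneSimple M
    triangles : ∀ x → FaceSize M x 3

record SemiMPG (M : CombMap) (n : ℕ) (o : Fin (d M)) : Set where
  field
    plane      : PlaneSimple M
    outer-size : FaceSize M o n
    outer-gon  : ∀ i j → i < n → j < n →
                   SameVertex M (iter (φ M) i o) (iter (φ M) j o) → i ≡ j
    triangles  : ∀ x → ¬ SameFace M o x → FaceSize M x 3

ExactlyOne : Bool → Bool → Bool → Set
ExactlyOne true  false false = ⊤
ExactlyOne false true  false = ⊤
ExactlyOne false false true  = ⊤
ExactlyOne _     _     _     = ⊥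

-- An R-tiling: colouring of edges (as α-invariant colouring of darts; true = red)
-- such that every triangular face counted by `Inner` has exactly one red edge.
record RTiling (M : CombMap) (Inner : Fin (d M) → Set) (red : Fin (d M) → Bool) : Set where
  field
    edge-colour : ∀ x → red (α M x) ≡ red x
    one-red     : ∀ x → Inner x →
                    ExactlyOne (red x) (red (φ M x)) (red (φ M (φ M x)))

-- Grand: a partition V(M) = V13 ⊎ V24 (as a vertex-constant Bool labelling of darts,
-- true = V13) such that black edges join V13 to V24 and red edges do not.
Grand : (M : CombMap) → (Fin (d M) → Bool) → Set
Grand M red =
  Σ (Fin (d M) → Bool) λ part →
    (∀ x → part (σ M x) ≡ part x) ×
    (∀ x → red x ≡ false → part x ≢ part (α M x)) ×
    (∀ x → red x ≡ true  → part x ≡ part (α M x))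

{-# OPTIONS --safe #-}
-- Let w = not ∘ red mark the black edges; the R-tiling condition says that every inner triangle
-- has an even number of black edges. Consider the double cover of the map whose darts are pairs
-- (dart , sheet), where crossing a black edge changes the sheet. Every vertex lifts to two vertices
-- and, by the parity condition, every inner face to two faces, so the cover has 2V vertices, 2E
-- edges and at least 2F − 1 faces. A connected map satisfies Euler's inequality V − E + F ≤ 2,
-- proved by inserting its edges one at a time: an edge inside a face splits it into at most two
-- faces, an edge between two faces merges them and joins at most two components. As V − E + F = 2
-- for M, the cover would violate this inequality, so it is disconnected: the parity of the black
-- edges along a walk from a base dart depends only on the endpoint. That parity is constant around
-- each vertex and is the partition V13 ⊎ V24.
module Submission where

open import Defs
open import Data.Nat using (ℕ; zero; suc; _+_; _*_; _∸_; _≤_; _<_; z≤n; s≤s; _<?_; _≤?_; pred)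
open import Data.Nat.Properties hiding (_≟_)
open import Data.Nat.Tactic.RingSolver using (solve-∀)
open import Data.Fin as F using (Fin; toℕ; fromℕ<; fromℕ; inject₁; punchIn; punchOut; _↑ˡ_; _↑ʳ_; splitAt)
import Data.Fin.Properties as FP
open import Data.Bool as B using (Bool; true; false; not; _xor_)
open import Data.Bool.Properties using (xor-assoc; xor-comm; xor-identityʳ; xor-same; not-¬)
open import Data.Product using (Σ; ∃; _×_; _,_; proj₁; proj₂)
open import Data.Sum using (_⊎_; inj₁; inj₂)
open import Data.Unit using (⊤; tt)
open import Data.Empty using (⊥; ⊥-elim)
open import Function using (_∘_)
open import Function.Definitions using (Injective)
open import Relation.Nullary using (¬_; Dec; yes; no)
import Relation.Nullary.Decidable as Dec
open import Relation.Nullary.Decidable using (_×-dec_)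
open import Relation.Binary.Definitions using (DecidableEquality)
open import Relation.Binary.PropositionalEquality
open import Algebra.Properties.CommutativeMonoid.Sum +-0-commutativeMonoid using (sum; sum-remove; sum-cong-≗; sum-replicate-zero)

private variable
  A X : Set

iter-+ : (f : A → A) (j k : ℕ) (x : A) → iter f (j + k) x ≡ iter f j (iter f k x)
iter-+ f zero    k x = refl
iter-+ f (suc j) k x = cong f (iter-+ f j k x)

iter-sucʳ : (f : A → A) (k : ℕ) (x : A) → iter f (suc k) x ≡ iter f k (f x)
iter-sucʳ f zero    x = refl
iter-sucʳ f (suc k) x = cong f (iter-sucʳ f k x)

iter-cong : {f g : A → A} → f ≗ g → ∀ k x → iter f k x ≡ iter g k x
iter-cong         f≗g zero    x = refl
iter-cong {g = g} f≗g (suc k) x = trans (f≗g _) (cong g (iter-cong f≗g k x))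

iter-injective : {f : A → A} → Injective _≡_ _≡_ f → ∀ k → Injective _≡_ _≡_ (iter f k)
iter-injective f-inj zero    eq = eq
iter-injective f-inj (suc k) eq = iter-injective f-inj k (f-inj eq)

Reaches : (A → A) → A → A → Set
Reaches f x y = ∃ λ k → iter f k x ≡ y

reaches-refl : {f : A → A} {x : A} → Reaches f x x
reaches-refl = 0 , refl

reaches-step : (f : A → A) (x : A) → Reaches f x (f x)
reaches-step f x = 1 , refl

reaches-trans : {f : A → A} {x y z : A} → Reaches f x y → Reaches f y z → Reaches f x z
reaches-trans {f = f} {x} (k , refl) (j , refl) = j + k , iter-+ f j k x

reaches-cong : {f g : A → A} → f ≗ g → {x y : A} → Reaches f x y → Reaches g x y
reaches-cong f≗g {x} (k , refl) = k , sym (iter-cong f≗g k x)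

reaches-invariant : {B : Set} {f : A → A} (L : A → B) → (∀ x → L (f x) ≡ L x) →
                    {x y : A} → Reaches f x y → L x ≡ L y
reaches-invariant L L-inv (zero  , refl) = refl
reaches-invariant L L-inv (suc k , refl) = trans (reaches-invariant L L-inv (k , refl)) (sym (L-inv _))

record Enumeration (X : Set) (N : ℕ) : Set where
  field
    index         : X → Fin N
    element       : Fin N → X
    element-index : ∀ x → element (index x) ≡ x
    index-element : ∀ i → index (element i) ≡ i

  index-injective : Injective _≡_ _≡_ index
  index-injective {x} {y} eq = trans (sym (element-index x)) (trans (cong element eq) (element-index y))

  _≟_ : DecidableEquality X
  x ≟ y = Dec.map′ index-injective (cong index) (index x F.≟ index y)

×Bool-enumeration : ∀ n → Enumeration (Fin n × Bool) (n + n)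
×Bool-enumeration n = record
  { index = index ; element = element ; element-index = element-index ; index-element = index-element }
  where
  index : Fin n × Bool → Fin (n + n)
  index (i , false) = i ↑ˡ n
  index (i , true)  = n ↑ʳ i

  fromSplit : Fin n ⊎ Fin n → Fin n × Bool
  fromSplit (inj₁ i) = i , false
  fromSplit (inj₂ i) = i , true

  element : Fin (n + n) → Fin n × Bool
  element j = fromSplit (splitAt n j)

  element-index : ∀ p → element (index p) ≡ p
  element-index (i , false) = cong fromSplit (FP.splitAt-↑ˡ n i n)
  element-index (i , true)  = cong fromSplit (FP.splitAt-↑ʳ n n i)

  index-element : ∀ j → index (element j) ≡ j
  index-element j with splitAt n j in eq
  ... | inj₁ i = FP.splitAt⁻¹-↑ˡ eq
  ... | inj₂ i = FP.splitAt⁻¹-↑ʳ eq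

module Orbits {N : ℕ} (E : Enumeration X N) (π : X → X) (π-injective : Injective _≡_ _≡_ π) where
  open Enumeration E

  period : ∀ x → ∃ λ p → p < N × iter π (suc p) x ≡ x
  period x with FP.pigeonhole (n<1+n N) (λ i → index (iter π (toℕ i) x))
  ... | i , j , i<j , same = p , p<N , sym (iter-injective π-injective (toℕ i) returns)
    where
    p : ℕ
    p = toℕ j ∸ suc (toℕ i)
    i+1+p≡j : toℕ i + suc p ≡ toℕ j
    i+1+p≡j = trans (+-suc (toℕ i) p) (m+[n∸m]≡n i<j)
    p<N : p < N
    p<N = ≤-trans (m≤n+m (suc p) (toℕ i)) (≤-trans (≤-reflexive i+1+p≡j) (≤-pred (FP.toℕ<n j)))
    returns : iter π (toℕ i) x ≡ iter π (toℕ i) (iter π (suc p) x)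
    returns = begin
      iter π (toℕ i) x                   ≡⟨ index-injective same ⟩
      iter π (toℕ j) x                   ≡⟨ cong (λ n → iter π n x) (sym i+1+p≡j) ⟩
      iter π (toℕ i + suc p) x           ≡⟨ iter-+ π (toℕ i) (suc p) x ⟩
      iter π (toℕ i) (iter π (suc p) x)  ∎
      where open ≡-Reasoning

  reaches-within-period : ∀ x k → ∃ λ j → j ≤ proj₁ (period x) × iter π j x ≡ iter π k x
  reaches-within-period x zero = 0 , z≤n , refl
  reaches-within-period x (suc k) with reaches-within-period x k
  ... | j , j≤p , eq with j <? proj₁ (period x)
  ...   | yes j<p = suc j , j<p , cong π eq
  ...   | no  j≮p = 0 , z≤n , (begin
    x                              ≡⟨ sym (proj₂ (proj₂ (period x))) ⟩
    iter π (suc (proj₁ (period x))) x ≡⟨ cong (λ n → iter π (suc n) x) (≤-antisym (≮⇒≥ j≮p) j≤p) ⟩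
    π (iter π j x)                 ≡⟨ cong π eq ⟩
    iter π (suc k) x               ∎)
    where open ≡-Reasoning

  reaches-sym : ∀ {x y} → Reaches π x y → Reaches π y x
  reaches-sym {x} (k , refl) with reaches-within-period x k
  ... | j , j≤p , eq = suc p ∸ j , (begin
    iter π (suc p ∸ j) (iter π k x)  ≡⟨ cong (iter π (suc p ∸ j)) (sym eq) ⟩
    iter π (suc p ∸ j) (iter π j x)  ≡⟨ sym (iter-+ π (suc p ∸ j) j x) ⟩
    iter π (suc p ∸ j + j) x         ≡⟨ cong (λ n → iter π n x) (m∸n+n≡m (m≤n⇒m≤1+n j≤p)) ⟩
    iter π (suc p) x                 ≡⟨ proj₂ (proj₂ (period x)) ⟩
    x                                ∎)
    where
    open ≡-Reasoning
    p : ℕ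
    p = proj₁ (period x)

  reaches? : ∀ x y → Dec (Reaches π x y)
  reaches? x y with FP.any? (λ (i : Fin N) → iter π (toℕ i) x ≟ y)
  ... | yes (i , eq) = yes (toℕ i , eq)
  ... | no ¬short = no λ (k , eq) →
    let (j , j≤p , eq′) = reaches-within-period x k
        j<N = <-≤-trans (s≤s j≤p) (proj₁ (proj₂ (period x)))
    in ¬short (fromℕ< j<N , trans (cong (λ n → iter π n x) (FP.toℕ-fromℕ< j<N)) (trans eq′ eq))

OrbitsAtMost : (X → X) → ℕ → Set
OrbitsAtMost {X} π m = Σ (X → Fin m) λ U → ∀ x y → U x ≡ U y → Reaches π x y

OrbitsAtLeast : (X → X) → ℕ → Set
OrbitsAtLeast {X} π L = Σ (X → Fin L) λ Λ → (∀ x → Λ (π x) ≡ Λ x) × (∀ v → ∃ λ x → Λ x ≡ v)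

orbitsAtMost-cong : {π π′ : X → X} {m : ℕ} → π ≗ π′ → OrbitsAtMost π m → OrbitsAtMost π′ m
orbitsAtMost-cong π≗π′ (U , U-orbits) = U , λ x y eq → reaches-cong π≗π′ (U-orbits x y eq)

orbitsAtLeast≤orbitsAtMost : {π : X → X} {L m : ℕ} → OrbitsAtLeast π L → OrbitsAtMost π m → L ≤ m
orbitsAtLeast≤orbitsAtMost {X = X} {L = L} (Λ , Λ-inv , Λ-onto) (U , U-orbits) =
  FP.injective⇒≤ {f = U ∘ representative} representative-injective
  where
  representative : Fin L → X
  representative v = proj₁ (Λ-onto v)
  representative-injective : Injective _≡_ _≡_ (U ∘ representative)
  representative-injective {v} {v′} eq = begin
    v                       ≡⟨ sym (proj₂ (Λ-onto v)) ⟩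
    Λ (representative v)    ≡⟨ reaches-invariant Λ Λ-inv (U-orbits _ _ eq) ⟩
    Λ (representative v′)   ≡⟨ proj₂ (Λ-onto v′) ⟩
    v′                      ∎
    where open ≡-Reasoning

module Identify {m : ℕ} (i j : Fin (suc m)) (i≢j : i ≢ j) where

  private
    redirect : Fin (suc m) → Fin (suc m)
    redirect ℓ with ℓ F.≟ j
    ... | yes _ = i
    ... | no  _ = ℓ

    redirect-j : redirect j ≡ i
    redirect-j with j F.≟ j
    ... | yes _   = refl
    ... | no  j≢j = ⊥-elim (j≢j refl)

    redirect-other : ∀ ℓ → ℓ ≢ j → redirect ℓ ≡ ℓ
    redirect-other ℓ ℓ≢j with ℓ F.≟ j
    ... | yes ℓ≡j = ⊥-elim (ℓ≢j ℓ≡j)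
    ... | no  _   = refl

    j≢redirect : ∀ ℓ → j ≢ redirect ℓ
    j≢redirect ℓ with ℓ F.≟ j
    ... | yes _   = i≢j ∘ sym
    ... | no  ℓ≢j = ℓ≢j ∘ sym

  identify : Fin (suc m) → Fin m
  identify ℓ = punchOut (j≢redirect ℓ)

  identify-j : identify j ≡ identify i
  identify-j = FP.punchOut-cong j (trans redirect-j (sym (redirect-other i i≢j)))

  identify-punchIn : ∀ v → identify (punchIn j v) ≡ v
  identify-punchIn v =
    trans (FP.punchOut-cong j (redirect-other (punchIn j v) (FP.punchInᵢ≢i j v))) (FP.punchOut-punchIn j)

  IorJ : Fin (suc m) → Set
  IorJ ℓ = ℓ ≡ i ⊎ ℓ ≡ j

  identify-injective : ∀ ℓ ℓ′ → identify ℓ ≡ identify ℓ′ → ℓ ≡ ℓ′ ⊎ (IorJ ℓ × IorJ ℓ′)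
  identify-injective ℓ ℓ′ eq = cases (ℓ F.≟ j) (ℓ′ F.≟ j)
    where
    same : redirect ℓ ≡ redirect ℓ′
    same = FP.punchOut-injective (j≢redirect ℓ) (j≢redirect ℓ′) eq
    cases : Dec (ℓ ≡ j) → Dec (ℓ′ ≡ j) → ℓ ≡ ℓ′ ⊎ (IorJ ℓ × IorJ ℓ′)
    cases (yes ℓ≡j) (yes ℓ′≡j) = inj₁ (trans ℓ≡j (sym ℓ′≡j))
    cases (yes ℓ≡j) (no  ℓ′≢j) =
      inj₂ (inj₂ ℓ≡j , inj₁ (trans (sym (redirect-other ℓ′ ℓ′≢j)) (trans (sym same) (trans (cong redirect ℓ≡j) redirect-j))))
    cases (no  ℓ≢j) (yes ℓ′≡j) =
      inj₂ (inj₁ (trans (sym (redirect-other ℓ ℓ≢j)) (trans same (trans (cong redirect ℓ′≡j) redirect-j))) , inj₂ ℓ′≡j)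
    cases (no  ℓ≢j) (no  ℓ′≢j) = inj₁ (trans (sym (redirect-other ℓ ℓ≢j)) (trans same (redirect-other ℓ′ ℓ′≢j)))

orbitsAtLeast-punctured : {π : X → X} {L : ℕ} (Λ : X → Fin L) → (∀ x → Λ (π x) ≡ Λ x) →
                          (i v₀ : Fin L) → i ≢ v₀ → (∀ v → v ≢ v₀ → ∃ λ x → Λ x ≡ v) →
                          OrbitsAtLeast π (pred L)
orbitsAtLeast-punctured {π = π} {L = suc L} Λ Λ-inv i v₀ i≢v₀ Λ-onto = identify ∘ Λ , Λ′-inv , Λ′-onto
  where
  open Identify i v₀ i≢v₀
  Λ′-inv : ∀ x → identify (Λ (π x)) ≡ identify (Λ x)
  Λ′-inv x = cong identify (Λ-inv x)
  Λ′-onto : ∀ v → ∃ λ x → identify (Λ x) ≡ v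
  Λ′-onto v = let (x , Λx≡v) = Λ-onto (punchIn v₀ v) (FP.punchInᵢ≢i v₀ v)
              in x , trans (cong identify Λx≡v) (identify-punchIn v)

module Swap (_≟_ : DecidableEquality X) where

  swap : X → X → X → X
  swap a b x with x ≟ a
  ... | yes _ = b
  ... | no  _ with x ≟ b
  ...   | yes _ = a
  ...   | no  _ = x

  swap-cases : ∀ a b x → a ≢ b →
               (x ≡ a × swap a b x ≡ b) ⊎ (x ≡ b × swap a b x ≡ a) ⊎ (x ≢ a × x ≢ b × swap a b x ≡ x)
  swap-cases a b x a≢b with x ≟ a
  ... | yes x≡a = inj₁ (x≡a , refl)
  ... | no  x≢a with x ≟ b
  ...   | yes x≡b = inj₂ (inj₁ (x≡b , refl))
  ...   | no  x≢b = inj₂ (inj₂ (x≢a , x≢b , refl))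

  swap-l : ∀ a b → a ≢ b → swap a b a ≡ b
  swap-l a b a≢b with swap-cases a b a a≢b
  ... | inj₁ (_ , eq)              = eq
  ... | inj₂ (inj₁ (a≡b , _))      = ⊥-elim (a≢b a≡b)
  ... | inj₂ (inj₂ (a≢a , _ , _))  = ⊥-elim (a≢a refl)

  swap-r : ∀ a b → a ≢ b → swap a b b ≡ a
  swap-r a b a≢b with swap-cases a b b a≢b
  ... | inj₁ (b≡a , _)             = ⊥-elim (a≢b (sym b≡a))
  ... | inj₂ (inj₁ (_ , eq))       = eq
  ... | inj₂ (inj₂ (_ , b≢b , _))  = ⊥-elim (b≢b refl)

  swap-other : ∀ a b x → a ≢ b → x ≢ a → x ≢ b → swap a b x ≡ x
  swap-other a b x a≢b x≢a x≢b with swap-cases a b x a≢b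
  ... | inj₁ (x≡a , _)             = ⊥-elim (x≢a x≡a)
  ... | inj₂ (inj₁ (x≡b , _))      = ⊥-elim (x≢b x≡b)
  ... | inj₂ (inj₂ (_ , _ , eq))   = eq

  swap-invariant : {B : Set} (K : X → B) → ∀ a b → a ≢ b → K a ≡ K b → ∀ x → K (swap a b x) ≡ K x
  swap-invariant K a b a≢b Ka≡Kb x with swap-cases a b x a≢b
  ... | inj₁ (refl , eq)           = trans (cong K eq) (sym Ka≡Kb)
  ... | inj₂ (inj₁ (refl , eq))    = trans (cong K eq) Ka≡Kb
  ... | inj₂ (inj₂ (_ , _ , eq))   = cong K eq

module Transposition {N : ℕ} (E : Enumeration X N)
    (π π′ : X → X) (π-injective : Injective _≡_ _≡_ π) (π′-injective : Injective _≡_ _≡_ π′)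
    (a b : X) (a≢b : a ≢ b) (π′≗π∘swap : ∀ x → π′ x ≡ π (Swap.swap (Enumeration._≟_ E) a b x)) where

  open Enumeration E using (_≟_)
  open Swap _≟_
  module O  = Orbits E π  π-injective
  module O′ = Orbits E π′ π′-injective

  private
    module Directed (a b : X) (πa : π′ a ≡ π b) (πb : π′ b ≡ π a)
                    (π-other : ∀ z → z ≢ a → z ≢ b → π′ z ≡ π z) where

      orbit-covered : ∀ {x} → Reaches π a x → Reaches π′ a x ⊎ Reaches π′ b x
      orbit-covered (zero  , refl) = inj₁ reaches-refl
      orbit-covered (suc k , refl) = covered-step (orbit-covered (k , refl))
        where
        covered-step : ∀ {z} → Reaches π′ a z ⊎ Reaches π′ b z → Reaches π′ a (π z) ⊎ Reaches π′ b (π z)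
        covered-step {z} r with z ≟ a | z ≟ b | r
        ... | yes refl | _        | _      = inj₂ (1 , πb)
        ... | no  _    | yes refl | _      = inj₁ (1 , πa)
        ... | no  z≢a  | no  z≢b  | inj₁ r = inj₁ (reaches-trans r (1 , π-other z z≢a z≢b))
        ... | no  z≢a  | no  z≢b  | inj₂ r = inj₂ (reaches-trans r (1 , π-other z z≢a z≢b))

      iterate-away : ∀ x → ¬ Reaches π a x → ¬ Reaches π b x → ∀ k → iter π′ k x ≡ iter π k x
      iterate-away x a↛x b↛x zero    = refl
      iterate-away x a↛x b↛x (suc k) =
        trans (cong π′ (iterate-away x a↛x b↛x k))
              (π-other _ (λ eq → a↛x (O.reaches-sym (k , eq))) (λ eq → b↛x (O.reaches-sym (k , eq))))

      -- the π-path from u to b avoids a, so π′ agrees with π along it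
      path-to-b : ∀ t u → iter π t u ≡ b → ¬ Reaches π a u → Reaches π′ u b
      path-to-b zero    u eq a↛u = 0 , eq
      path-to-b (suc t) u eq a↛u with u ≟ b | u ≟ a
      ... | yes refl | _        = reaches-refl
      ... | no  _    | yes refl = ⊥-elim (a↛u reaches-refl)
      ... | no  u≢b  | no  u≢a  =
        reaches-trans (1 , π-other u u≢a u≢b)
          (path-to-b t (π u) (trans (sym (iter-sucʳ π t u)) eq)
            (λ a→πu → a↛u (reaches-trans a→πu (O.reaches-sym (reaches-step π u)))))

      joins : ¬ Reaches π a b → Reaches π′ a b
      joins a↛b = reaches-trans (1 , πa) (path-to-b p (π b) πb→b (λ a→πb → a↛b (reaches-trans a→πb (p , πb→b))))
        where
        p : ℕ
        p = proj₁ (O.period b)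
        πb→b : iter π p (π b) ≡ b
        πb→b = trans (sym (iter-sucʳ π p b)) (proj₂ (proj₂ (O.period b)))

    πa : π′ a ≡ π b
    πa = trans (π′≗π∘swap a) (cong π (swap-l a b a≢b))
    πb : π′ b ≡ π a
    πb = trans (π′≗π∘swap b) (cong π (swap-r a b a≢b))
    π-other : ∀ z → z ≢ a → z ≢ b → π′ z ≡ π z
    π-other z z≢a z≢b = trans (π′≗π∘swap z) (cong π (swap-other a b z a≢b z≢a z≢b))

    module AB = Directed a b πa πb π-other
    module BA = Directed b a πb πa (λ z z≢b z≢a → π-other z z≢a z≢b)

  orbit-refines : ¬ Reaches π a b → ∀ {x y} → Reaches π x y → Reaches π′ x y
  orbit-refines a↛b (zero  , refl) = reaches-refl
  orbit-refines a↛b (suc k , refl) = reaches-trans (orbit-refines a↛b (k , refl)) (π-step _)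
    where
    π-step : ∀ z → Reaches π′ z (π z)
    π-step z with z ≟ a | z ≟ b
    ... | yes refl | _        = reaches-trans (AB.joins a↛b) (1 , πb)
    ... | no  _    | yes refl = reaches-trans (BA.joins (a↛b ∘ O.reaches-sym)) (1 , πa)
    ... | no  z≢a  | no  z≢b  = 1 , π-other z z≢a z≢b

  orbitsAtMost-split : ∀ {m} → OrbitsAtMost π m → OrbitsAtMost π′ (suc m)
  orbitsAtMost-split {m} (U , U-orbits) = U′ , U′-orbits
    where
    -- the π′-orbit of b gets the new label; every other π′-orbit keeps its π-label
    label : ∀ {x} → Dec (Reaches π′ b x) → Fin m → Fin (suc m)
    label (yes _) _ = fromℕ m
    label (no  _) u = inject₁ u
    U′ : X → Fin (suc m)
    U′ x = label (O′.reaches? b x) (U x)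

    via : ∀ {c x} → (Reaches π c x → Reaches π′ a x ⊎ Reaches π′ b x) → ¬ Reaches π′ b x → Reaches π c x → Reaches π′ a x
    via covered b↛x c→x with covered c→x
    ... | inj₁ a→x = a→x
    ... | inj₂ b→x = ⊥-elim (b↛x b→x)

    U′-orbits : ∀ x y → U′ x ≡ U′ y → Reaches π′ x y
    U′-orbits x y eq with O′.reaches? b x | O′.reaches? b y
    ... | yes b→x | yes b→y = reaches-trans (O′.reaches-sym b→x) b→y
    ... | yes _   | no  _   = ⊥-elim (FP.fromℕ≢inject₁ eq)
    ... | no  _   | yes _   = ⊥-elim (FP.fromℕ≢inject₁ (sym eq))
    ... | no  b↛x | no  b↛y with U-orbits x y (FP.inject₁-injective eq) | O.reaches? a x | O.reaches? b x
    ...   | x→y | yes a→x | _       =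
      reaches-trans (O′.reaches-sym (via AB.orbit-covered b↛x a→x)) (via AB.orbit-covered b↛y (reaches-trans a→x x→y))
    ...   | x→y | no  _   | yes b→x =
      reaches-trans (O′.reaches-sym (via (Data.Sum.swap ∘ BA.orbit-covered) b↛x b→x))
                    (via (Data.Sum.swap ∘ BA.orbit-covered) b↛y (reaches-trans b→x x→y))
    ...   | (k , refl) | no a↛x | no b↛x′ = k , AB.iterate-away x a↛x b↛x′ k

  orbitsAtMost-merge : ∀ {m} → ¬ Reaches π a b → OrbitsAtMost π (suc m) → OrbitsAtMost π′ m
  orbitsAtMost-merge a↛b (U , U-orbits) = identify ∘ U , U′-orbits
    where
    open Identify (U a) (U b) (a↛b ∘ U-orbits a b)
    to-a : ∀ x → IorJ (U x) → Reaches π′ x a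
    to-a x (inj₁ Ux≡Ua) = orbit-refines a↛b (U-orbits x a Ux≡Ua)
    to-a x (inj₂ Ux≡Ub) = reaches-trans (orbit-refines a↛b (U-orbits x b Ux≡Ub)) (O′.reaches-sym (AB.joins a↛b))
    U′-orbits : ∀ x y → identify (U x) ≡ identify (U y) → Reaches π′ x y
    U′-orbits x y eq with identify-injective (U x) (U y) eq
    ... | inj₁ Ux≡Uy         = orbit-refines a↛b (U-orbits x y Ux≡Uy)
    ... | inj₂ (x∈ab , y∈ab) = reaches-trans (to-a x x∈ab) (O′.reaches-sym (to-a y y∈ab))

bound-opening : ∀ s m p κ k → 2 * (s + m) + p ≤ 4 * κ + k → 2 * (s + m) + suc p ≤ 4 * κ + suc k
bound-opening s m p κ k h = begin
  2 * (s + m) + suc p     ≡⟨ +-suc (2 * (s + m)) p ⟩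
  suc (2 * (s + m) + p)   ≤⟨ s≤s h ⟩
  suc (4 * κ + k)         ≡⟨ sym (+-suc (4 * κ) k) ⟩
  4 * κ + suc k           ∎
  where open ≤-Reasoning

bound-within : ∀ s m p κ k → 2 * (s + m) + suc p ≤ 4 * κ + k → 2 * (s + suc m) + p ≤ 4 * κ + suc k
bound-within s m p κ k h = begin
  2 * (s + suc m) + p       ≡⟨ shift s m p ⟩
  suc (2 * (s + m) + suc p) ≤⟨ s≤s h ⟩
  suc (4 * κ + k)           ≡⟨ sym (+-suc (4 * κ) k) ⟩
  4 * κ + suc k             ∎
  where
  open ≤-Reasoning
  shift : ∀ s m p → 2 * (s + suc m) + p ≡ suc (2 * (s + m) + suc p)
  shift = solve-∀

bound-across : ∀ s m p κ κ′ k → 2 * (s + suc m) + suc p ≤ 4 * κ + k → κ ≤ suc κ′ →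
               2 * (s + m) + p ≤ 4 * κ′ + suc k
bound-across s m p κ κ′ k h κ≤ = +-cancelʳ-≤ 3 _ _ (begin
  2 * (s + m) + p + 3        ≡⟨ shiftˡ s m p ⟩
  2 * (s + suc m) + suc p    ≤⟨ h ⟩
  4 * κ + k                  ≤⟨ +-monoˡ-≤ k (*-monoʳ-≤ 4 κ≤) ⟩
  4 * suc κ′ + k             ≡⟨ shiftʳ κ′ k ⟩
  4 * κ′ + suc k + 3         ∎)
  where
  open ≤-Reasoning
  shiftˡ : ∀ s m p → 2 * (s + m) + p + 3 ≡ 2 * (s + suc m) + suc p
  shiftˡ = solve-∀
  shiftʳ : ∀ κ k → 4 * suc κ + k ≡ 4 * κ + suc k + 3
  shiftʳ = solve-∀

bound-final : ∀ s m p κ N L → 2 * (s + m) + p ≤ 4 * κ + N → κ ≤ 1 → L ≤ m → 2 * (s + L) ≤ N + 4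
bound-final s m p κ N L h κ≤1 L≤m = begin
  2 * (s + L)       ≤⟨ *-monoʳ-≤ 2 (+-monoʳ-≤ s L≤m) ⟩
  2 * (s + m)       ≤⟨ m≤m+n _ p ⟩
  2 * (s + m) + p   ≤⟨ h ⟩
  4 * κ + N         ≤⟨ +-monoˡ-≤ N (*-monoʳ-≤ 4 κ≤1) ⟩
  4 + N             ≡⟨ +-comm 4 N ⟩
  N + 4             ∎
  where open ≤-Reasoning

indicator : {P : Set} → Dec P → ℕ
indicator (yes _) = 1
indicator (no  _) = 0

indicator-yes : {P : Set} → P → (p? : Dec P) → indicator p? ≡ 1
indicator-yes p (yes _)  = refl
indicator-yes p (no ¬p)  = ⊥-elim (¬p p)

indicator-no : {P : Set} → ¬ P → (p? : Dec P) → indicator p? ≡ 0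
indicator-no ¬p (yes p) = ⊥-elim (¬p p)
indicator-no ¬p (no _)  = refl

indicator-cong : {P Q : Set} → (P → Q) → (Q → P) → (p? : Dec P) (q? : Dec Q) → indicator p? ≡ indicator q?
indicator-cong to from (yes _) (yes _) = refl
indicator-cong to from (yes p) (no ¬q) = ⊥-elim (¬q (to p))
indicator-cong to from (no ¬p) (yes q) = ⊥-elim (¬p (from q))
indicator-cong to from (no _)  (no _)  = refl

sum-update-one : ∀ {n} (f g : Fin n → ℕ) (i : Fin n) → (∀ j → j ≢ i → f j ≡ g j) → f i ≡ 0 → g i ≡ 1 →
                 sum g ≡ suc (sum f)
sum-update-one {suc n} f g i agree fi≡0 gi≡1 = begin
  sum g                             ≡⟨ sum-remove {i = i} g ⟩
  g i + sum (g ∘ punchIn i)         ≡⟨ cong₂ _+_ gi≡1 (sum-cong-≗ rest) ⟩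
  1 + sum (f ∘ punchIn i)           ≡⟨ cong (λ t → 1 + (t + sum (f ∘ punchIn i))) (sym fi≡0) ⟩
  1 + (f i + sum (f ∘ punchIn i))   ≡⟨ cong suc (sym (sum-remove {i = i} f)) ⟩
  suc (sum f)                       ∎
  where
  open ≡-Reasoning
  rest : ∀ j → g (punchIn i j) ≡ f (punchIn i j)
  rest j = sym (agree (punchIn i j) (FP.punchInᵢ≢i i j))

module EulerInequality {N : ℕ} (E : Enumeration X N)
    (σ : X → X) (σ-injective : Injective _≡_ _≡_ σ)
    (α : X → X) (α-involutive : ∀ x → α (α x) ≡ x) (α-fixedPointFree : ∀ x → α x ≢ x) where

  open Enumeration E
  open Swap _≟_

  data Linked : X → X → Set where
    linked-refl  : ∀ {x} → Linked x x
    linked-sym   : ∀ {x y} → Linked x y → Linked y x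
    linked-trans : ∀ {x y z} → Linked x y → Linked y z → Linked x z
    linked-σ     : ∀ x → Linked x (σ x)
    linked-α     : ∀ x → Linked x (α x)

  linked-invariant : {B : Set} (K : X → B) → (∀ x → K (σ x) ≡ K x) → (∀ x → K (α x) ≡ K x) →
                     ∀ {x y} → Linked x y → K x ≡ K y
  linked-invariant K K-σ K-α linked-refl          = refl
  linked-invariant K K-σ K-α (linked-sym l)       = sym (linked-invariant K K-σ K-α l)
  linked-invariant K K-σ K-α (linked-trans l l′)  = trans (linked-invariant K K-σ K-α l) (linked-invariant K K-σ K-α l′)
  linked-invariant K K-σ K-α (linked-σ x)         = sym (K-σ x)
  linked-invariant K K-σ K-α (linked-α x)         = sym (K-α x)

  ComponentsAtLeast : (X → X) → ℕ → Set
  ComponentsAtLeast β κ =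
    Σ (X → Fin κ) λ K → (∀ x → K (σ x) ≡ K x) × (∀ x → K (β x) ≡ K x) × (∀ v → ∃ λ x → K x ≡ v)

  componentsAtLeast-cong : ∀ {β β′ κ} → β′ ≗ β → ComponentsAtLeast β κ → ComponentsAtLeast β′ κ
  componentsAtLeast-cong β′≗β (K , K-σ , K-β , K-onto) = K , K-σ , (λ x → trans (cong K (β′≗β x)) (K-β x)) , K-onto

  componentsAtLeast≤1 : ∀ {κ} → (∀ x y → Linked x y) → ComponentsAtLeast α κ → κ ≤ 1
  componentsAtLeast≤1 {zero}        _         _                      = z≤n
  componentsAtLeast≤1 {suc zero}    _         _                      = ≤-refl
  componentsAtLeast≤1 {suc (suc κ)} connected (K , K-σ , K-α , K-onto) =
    let (x₀ , Kx₀≡0) = K-onto F.zero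
        (x₁ , Kx₁≡1) = K-onto (F.suc F.zero)
    in ⊥-elim (FP.0≢1+n (trans (sym Kx₀≡0) (trans (linked-invariant K K-σ K-α (connected x₀ x₁)) Kx₁≡1)))

  module _ {β β′ : X → X} (a b : X) (a≢b : a ≢ b) (β′≗β∘swap : ∀ x → β′ x ≡ β (swap a b x)) where

    private
      β′-invariant : {B : Set} (K : X → B) → (∀ x → K (β x) ≡ K x) → K a ≡ K b → ∀ x → K (β′ x) ≡ K x
      β′-invariant K K-β Ka≡Kb x = trans (cong K (β′≗β∘swap x)) (trans (K-β _) (swap-invariant K a b a≢b Ka≡Kb x))

    componentsAtLeast-swap-within : ∀ {κ} → Reaches (σ ∘ β) a b → ComponentsAtLeast β κ → ComponentsAtLeast β′ κ
    componentsAtLeast-swap-within a→b (K , K-σ , K-β , K-onto) =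
      K , K-σ , β′-invariant K K-β (reaches-invariant K (λ x → trans (K-σ _) (K-β x)) a→b) , K-onto

    componentsAtLeast-swap : ∀ {κ} → ComponentsAtLeast β κ → ∃ λ κ′ → κ ≤ suc κ′ × ComponentsAtLeast β′ κ′
    componentsAtLeast-swap {κ} (K , K-σ , K-β , K-onto) with K a F.≟ K b
    ... | yes Ka≡Kb = κ , n≤1+n κ , K , K-σ , β′-invariant K K-β Ka≡Kb , K-onto
    componentsAtLeast-swap {zero}  (K , _) | no _ = ⊥-elim (FP.¬Fin0 (K a))
    componentsAtLeast-swap {suc κ} (K , K-σ , K-β , K-onto) | no Ka≢Kb =
      κ , ≤-refl , identify ∘ K , cong identify ∘ K-σ ,
      β′-invariant (identify ∘ K) (cong identify ∘ K-β) (sym identify-j) , K′-onto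
      where
      open Identify (K a) (K b) Ka≢Kb
      K′-onto : ∀ v → ∃ λ x → identify (K x) ≡ v
      K′-onto v = let (x , Kx≡) = K-onto (punchIn (K b) v) in x , trans (cong identify Kx≡) (identify-punchIn v)

  pos : X → ℕ
  pos x = toℕ (index x)

  Active : ℕ → X → Set
  Active k x = pos x < k × pos (α x) < k

  active-α : ∀ {k x} → Active k x → Active k (α x)
  active-α {k} {x} (x<k , αx<k) = αx<k , subst (λ y → pos y < k) (sym (α-involutive x)) x<k

  αₖ : ℕ → X → X
  αₖ k x with pos x <? k ×-dec pos (α x) <? k
  ... | yes _ = α x
  ... | no  _ = x

  αₖ-active : ∀ {k x} → Active k x → αₖ k x ≡ α x
  αₖ-active {k} {x} act with pos x <? k ×-dec pos (α x) <? k
  ... | yes _   = refl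
  ... | no  ¬act = ⊥-elim (¬act act)

  αₖ-inactive : ∀ {k x} → ¬ Active k x → αₖ k x ≡ x
  αₖ-inactive {k} {x} ¬act with pos x <? k ×-dec pos (α x) <? k
  ... | yes act = ⊥-elim (¬act act)
  ... | no  _   = refl

  αₖ-cong : ∀ {k k′} x → (Active k x → Active k′ x) → (Active k′ x → Active k x) → αₖ k x ≡ αₖ k′ x
  αₖ-cong {k} {k′} x to from with pos x <? k ×-dec pos (α x) <? k
  ... | yes act = sym (αₖ-active (to act))
  ... | no ¬act = sym (αₖ-inactive (¬act ∘ from))

  αₖ-injective : ∀ k → Injective _≡_ _≡_ (αₖ k)
  αₖ-injective k {x} {y} eq with pos x <? k ×-dec pos (α x) <? k | pos y <? k ×-dec pos (α y) <? k
  ... | yes _   | yes _    = trans (sym (α-involutive x)) (trans (cong α eq) (α-involutive y))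
  ... | yes act | no ¬act  = ⊥-elim (¬act (subst (Active k) eq (active-α act)))
  ... | no ¬act | yes act  = ⊥-elim (¬act (subst (Active k) (sym eq) (active-α act)))
  ... | no _    | no _     = eq

  αₖ-zero : ∀ x → αₖ 0 x ≡ x
  αₖ-zero x = αₖ-inactive {0} λ ()

  αₖ-all : ∀ x → αₖ N x ≡ α x
  αₖ-all x = αₖ-active (FP.toℕ<n (index x) , FP.toℕ<n (index (α x)))

  πₖ : ℕ → X → X
  πₖ k x = σ (αₖ k x)

  πₖ-injective : ∀ k → Injective _≡_ _≡_ (πₖ k)
  πₖ-injective k = αₖ-injective k ∘ σ-injective

  Dangling : ℕ → X → Set
  Dangling k x = pos x < k × k ≤ pos (α x)

  dangling? : ∀ k x → Dec (Dangling k x)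
  dangling? k x = pos x <? k ×-dec k ≤? pos (α x)

  danglingCount : ℕ → ℕ
  danglingCount k = sum λ i → indicator (dangling? k (element i))

  danglingCount-zero : danglingCount 0 ≡ 0
  danglingCount-zero = trans (sum-cong-≗ (λ i → indicator-no (λ ()) (dangling? 0 (element i))))
                             (sum-replicate-zero N)

  danglingCount-moves : ∀ {k₁ k₂} x → (∀ y → y ≢ x → indicator (dangling? k₁ y) ≡ indicator (dangling? k₂ y)) →
                        ¬ Dangling k₁ x → Dangling k₂ x → danglingCount k₂ ≡ suc (danglingCount k₁)
  danglingCount-moves {k₁} {k₂} x others ¬d₁ d₂ =
    sum-update-one _ _ (index x)
      (λ j j≢ix → others (element j) (λ eq → j≢ix (trans (sym (index-element j)) (cong index eq))))
      (trans (at k₁) (indicator-no ¬d₁ (dangling? k₁ x)))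
      (trans (at k₂) (indicator-yes d₂ (dangling? k₂ x)))
    where
    at : ∀ k → indicator (dangling? k (element (index x))) ≡ indicator (dangling? k x)
    at k = cong (indicator ∘ dangling? k) (element-index x)

  module Step (k : ℕ) (k<N : k < N) where

    c : X
    c = element (fromℕ< k<N)

    pos-c : pos c ≡ k
    pos-c = trans (cong toℕ (index-element _)) (FP.toℕ-fromℕ< k<N)

    pos-αα-c : pos (α (α c)) ≡ k
    pos-αα-c = trans (cong pos (α-involutive c)) pos-c

    pos≡k⇒c : ∀ {x} → pos x ≡ k → x ≡ c
    pos≡k⇒c eq = index-injective (FP.toℕ-injective (trans eq (sym pos-c)))

    c≢αc : c ≢ α c
    c≢αc eq = α-fixedPointFree c (sym eq)

    α≢c : ∀ {x} → x ≢ α c → α x ≢ c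
    α≢c x≢αc αx≡c = x≢αc (trans (sym (α-involutive _)) (cong α αx≡c))

    <suc⇒< : ∀ {x} → x ≢ c → pos x < suc k → pos x < k
    <suc⇒< x≢c (s≤s x≤k) = ≤∧≢⇒< x≤k (x≢c ∘ pos≡k⇒c)

    ¬active-c : ¬ Active k c
    ¬active-c (c<k , _) = <-irrefl pos-c c<k

    ¬active-αc : ¬ Active k (α c)
    ¬active-αc (_ , ααc<k) = <-irrefl pos-αα-c ααc<k

    αₖ-suc-other : ∀ x → x ≢ c → α x ≢ c → αₖ (suc k) x ≡ αₖ k x
    αₖ-suc-other x x≢c αx≢c =
      αₖ-cong x (λ (x< , αx<) → <suc⇒< x≢c x< , <suc⇒< αx≢c αx<) (λ (x< , αx<) → m<n⇒m<1+n x< , m<n⇒m<1+n αx<)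

    indicator-suc-other : ∀ x → x ≢ c → α x ≢ c → indicator (dangling? (suc k) x) ≡ indicator (dangling? k x)
    indicator-suc-other x x≢c αx≢c = indicator-cong
      (λ (x< , k<) → <suc⇒< x≢c x< , <⇒≤ k<)
      (λ (x< , k≤) → m<n⇒m<1+n x< , ≤∧≢⇒< k≤ (αx≢c ∘ pos≡k⇒c ∘ sym))
      (dangling? (suc k) x) (dangling? k x)

    module Closing (αc<k : pos (α c) < k) where

      active-c : Active (suc k) c
      active-c = subst (_< suc k) (sym pos-c) ≤-refl , m<n⇒m<1+n αc<k

      αₖ-suc : ∀ x → αₖ (suc k) x ≡ αₖ k (swap c (α c) x)
      αₖ-suc x with swap-cases c (α c) x c≢αc
      ... | inj₁ (refl , eq) = begin
        αₖ (suc k) c                 ≡⟨ αₖ-active active-c ⟩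
        α c                          ≡⟨ sym (αₖ-inactive ¬active-αc) ⟩
        αₖ k (α c)                   ≡⟨ cong (αₖ k) (sym eq) ⟩
        αₖ k (swap c (α c) c)        ∎
        where open ≡-Reasoning
      ... | inj₂ (inj₁ (refl , eq)) = begin
        αₖ (suc k) (α c)             ≡⟨ αₖ-active (active-α active-c) ⟩
        α (α c)                      ≡⟨ α-involutive c ⟩
        c                            ≡⟨ sym (αₖ-inactive ¬active-c) ⟩
        αₖ k c                       ≡⟨ cong (αₖ k) (sym eq) ⟩
        αₖ k (swap c (α c) (α c))    ∎
        where open ≡-Reasoning
      ... | inj₂ (inj₂ (x≢c , x≢αc , eq)) = trans (αₖ-suc-other x x≢c (α≢c x≢αc)) (cong (αₖ k) (sym eq))

      danglingCount-suc : danglingCount k ≡ suc (danglingCount (suc k))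
      danglingCount-suc = danglingCount-moves (α c) others
        (λ (_ , k<ααc) → <-irrefl (sym pos-αα-c) k<ααc)
        (αc<k , ≤-reflexive (sym pos-αα-c))
        where
        others : ∀ y → y ≢ α c → indicator (dangling? (suc k) y) ≡ indicator (dangling? k y)
        others y y≢αc with y ≟ c
        ... | yes refl = trans (indicator-no (λ (_ , k<αc) → <-asym k<αc αc<k) (dangling? (suc k) c))
                               (sym (indicator-no (λ (c<k , _) → <-irrefl pos-c c<k) (dangling? k c)))
        ... | no  y≢c  = indicator-suc-other y y≢c (α≢c y≢αc)

    module Opening (αc≮k : ¬ pos (α c) < k) where

      k<αc : k < pos (α c)
      k<αc = ≤∧≢⇒< (≮⇒≥ αc≮k) (c≢αc ∘ sym ∘ pos≡k⇒c ∘ sym)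

      ¬active-suc-c : ¬ Active (suc k) c
      ¬active-suc-c (_ , αc<k+1) = <-asym k<αc (<suc⇒< (c≢αc ∘ sym) αc<k+1)

      αₖ-suc : ∀ x → αₖ (suc k) x ≡ αₖ k x
      αₖ-suc x with x ≟ c | x ≟ α c
      ... | yes refl | _        = trans (αₖ-inactive ¬active-suc-c) (sym (αₖ-inactive ¬active-c))
      ... | no  _    | yes refl = trans (αₖ-inactive (¬active-suc-c ∘ active-α′)) (sym (αₖ-inactive ¬active-αc))
        where
        active-α′ : Active (suc k) (α c) → Active (suc k) c
        active-α′ act = subst (Active (suc k)) (α-involutive c) (active-α act)
      ... | no  x≢c  | no  x≢αc = αₖ-suc-other x x≢c (α≢c x≢αc)

      danglingCount-suc : danglingCount (suc k) ≡ suc (danglingCount k)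
      danglingCount-suc = danglingCount-moves c others
        (λ (c<k , _) → <-irrefl pos-c c<k)
        (subst (_< suc k) (sym pos-c) ≤-refl , k<αc)
        where
        others : ∀ y → y ≢ c → indicator (dangling? k y) ≡ indicator (dangling? (suc k) y)
        others y y≢c with y ≟ α c
        ... | yes refl = trans (indicator-no (λ (αc<k , _) → αc≮k αc<k) (dangling? k (α c)))
                               (sym (indicator-no (λ (αc<k+1 , _) → αc≮k (<suc⇒< (c≢αc ∘ sym) αc<k+1))
                                                  (dangling? (suc k) (α c))))
        ... | no  y≢αc = sym (indicator-suc-other y y≢c (α≢c y≢αc))

  module _ {s : ℕ} (vertices≤ : OrbitsAtMost σ s) (vertices≥ : OrbitsAtLeast σ s) where

    -- With s = V, m an upper bound for the faces of πₖ k, κ a lower bound for the components and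
    -- 2 Eₖ = k − danglingCount k the edges of αₖ k, the inequality is V − Eₖ + m ≤ 2 κ.
    Invariant : ℕ → Set
    Invariant k = Σ ℕ λ m → Σ ℕ λ κ →
      OrbitsAtMost (πₖ k) m × ComponentsAtLeast (αₖ k) κ × 2 * (s + m) + danglingCount k ≤ 4 * κ + k

    invariant-zero : Invariant 0
    invariant-zero =
      s , s , orbitsAtMost-cong (cong σ ∘ sym ∘ αₖ-zero) vertices≤ , components , ≤-reflexive bound
      where
      components : ComponentsAtLeast (αₖ 0) s
      components = let (V , V-σ , V-onto) = vertices≥ in V , V-σ , cong V ∘ αₖ-zero , V-onto
      double : ∀ s → 2 * (s + s) + 0 ≡ 4 * s + 0
      double = solve-∀
      bound : 2 * (s + s) + danglingCount 0 ≡ 4 * s + 0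
      bound = trans (cong (2 * (s + s) +_) danglingCount-zero) (double s)

    module _ (k : ℕ) (k<N : k < N) where
      open Step k k<N

      invariant-opening : ¬ pos (α c) < k → Invariant k → Invariant (suc k)
      invariant-opening αc≮k (m , κ , faces , components , bound) =
        m , κ , orbitsAtMost-cong (cong σ ∘ sym ∘ αₖ-suc) faces , componentsAtLeast-cong αₖ-suc components ,
        subst (λ p → 2 * (s + m) + p ≤ 4 * κ + suc k) (sym danglingCount-suc) (bound-opening s m _ κ k bound)
        where open Opening αc≮k

      module _ (αc<k : pos (α c) < k) where
        open Closing αc<k
        module O = Orbits E (πₖ k) (πₖ-injective k)
        module T = Transposition E (πₖ k) (πₖ (suc k)) (πₖ-injective k) (πₖ-injective (suc k))
                                 c (α c) c≢αc (cong σ ∘ αₖ-suc)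

        invariant-closing : Invariant k → Invariant (suc k)
        invariant-closing (m , κ , faces , components , bound) with O.reaches? c (α c)
        ... | yes within =
          suc m , κ , T.orbitsAtMost-split faces ,
          componentsAtLeast-swap-within c (α c) c≢αc αₖ-suc within components ,
          bound-within s m _ κ k (subst (λ p → 2 * (s + m) + p ≤ 4 * κ + k) danglingCount-suc bound)
        ... | no across = merged faces bound
          where
          merged : ∀ {m} → OrbitsAtMost (πₖ k) m → 2 * (s + m) + danglingCount k ≤ 4 * κ + k → Invariant (suc k)
          merged {zero}  (U , _) _     = ⊥-elim (FP.¬Fin0 (U c))
          merged {suc m} faces′ bound′ =
            let (κ′ , κ≤ , components′) = componentsAtLeast-swap c (α c) c≢αc αₖ-suc components
            in m , κ′ , T.orbitsAtMost-merge across faces′ , components′ ,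
               bound-across s m _ κ κ′ k (subst (λ p → 2 * (s + suc m) + p ≤ 4 * κ + k) danglingCount-suc bound′) κ≤

      invariant-suc : Invariant k → Invariant (suc k)
      invariant-suc with pos (α c) <? k
      ... | yes αc<k = invariant-closing αc<k
      ... | no  αc≮k = invariant-opening αc≮k

    invariant : ∀ k → k ≤ N → Invariant k
    invariant zero    _   = invariant-zero
    invariant (suc k) k<N = invariant-suc k k<N (invariant k (<⇒≤ k<N))

  euler-inequality : ∀ {s L} → (∀ x y → Linked x y) → OrbitsAtMost σ s → OrbitsAtLeast σ s →
                     OrbitsAtLeast (σ ∘ α) L → 2 * (s + L) ≤ N + 4
  euler-inequality {s} {L} connected vertices≤ vertices≥ faces≥
    with invariant vertices≤ vertices≥ N ≤-refl
  ... | m , κ , faces≤ , components , bound =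
    bound-final s m _ κ N L bound
      (componentsAtLeast≤1 connected (componentsAtLeast-cong (sym ∘ αₖ-all) components))
      (orbitsAtLeast≤orbitsAtMost faces≥ (orbitsAtMost-cong (cong σ ∘ αₖ-all) faces≤))

module OrbitCount {D n : ℕ} {π : Fin D → Fin D} (h : HasOrbitCount π n) where

  label : Fin D → Fin n
  label = proj₁ h

  representative : Fin n → Fin D
  representative v = proj₁ (proj₁ (proj₂ h) v)

  label-representative : ∀ v → label (representative v) ≡ v
  label-representative v = proj₂ (proj₁ (proj₂ h) v)

  label⇒orbit : ∀ {x y} → label x ≡ label y → SameOrbit π x y
  label⇒orbit {x} {y} = proj₁ (proj₂ (proj₂ h) x y)

  orbit⇒label : ∀ {x y} → SameOrbit π x y → label x ≡ label y
  orbit⇒label {x} {y} = proj₂ (proj₂ (proj₂ h) x y)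

  label-π : ∀ x → label (π x) ≡ label x
  label-π x = sym (orbit⇒label (1 , refl))

parity : {M : CombMap} → (Fin (d M) → Bool) → {x y : Fin (d M)} → Reach M x y → Bool
parity w here          = false
parity w (stepσ P)     = parity w P
parity w (stepα {x} P) = w x xor parity w P

reach-trans : {M : CombMap} {x y z : Fin (d M)} → Reach M x y → Reach M y z → Reach M x z
reach-trans here      Q = Q
reach-trans (stepσ P) Q = stepσ (reach-trans P Q)
reach-trans (stepα P) Q = stepα (reach-trans P Q)

parity-trans : {M : CombMap} (w : Fin (d M) → Bool) {x y z : Fin (d M)} (P : Reach M x y) (Q : Reach M y z) →
               parity w (reach-trans P Q) ≡ parity w P xor parity w Q
parity-trans w here          Q = refl
parity-trans w (stepσ P)     Q = parity-trans w P Q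
parity-trans w (stepα {x} P) Q = trans (cong (w x xor_) (parity-trans w P Q)) (sym (xor-assoc (w x) _ _))

xor-cancelʳ : ∀ b t → (b xor t) xor t ≡ b
xor-cancelʳ b t = trans (xor-assoc b t t) (trans (cong (b xor_) (xor-same t)) (xor-identityʳ b))

xor-cancel-middle : ∀ b w t → (b xor w) xor (t xor w) ≡ b xor t
xor-cancel-middle false false false = refl
xor-cancel-middle false false true  = refl
xor-cancel-middle false true  false = refl
xor-cancel-middle false true  true  = refl
xor-cancel-middle true  false false = refl
xor-cancel-middle true  false true  = refl
xor-cancel-middle true  true  false = refl
xor-cancel-middle true  true  true  = refl

exactlyOne⇒evenBlack : ∀ a b c → ExactlyOne a b c → (not a xor not b) xor not c ≡ false
exactlyOne⇒evenBlack true  false false _ = refl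
exactlyOne⇒evenBlack false true  false _ = refl
exactlyOne⇒evenBlack false false true  _ = refl

double-cover-too-small : ∀ nV nF D → Fin nF → 2 * (nV + nF) ≡ D + 4 →
                         ¬ 2 * ((nV + nV) + pred (nF + nF)) ≤ (D + D) + 4
double-cover-too-small nV (suc n) D _ euler h = ≤⇒≯ (+-cancelˡ-≤ (D + D + 4) 4 2 (begin
  D + D + 4 + 4                        ≡⟨ sym (double-euler) ⟩
  2 * ((nV + nV) + (n + suc n)) + 2    ≤⟨ +-monoˡ-≤ 2 h ⟩
  D + D + 4 + 2                        ∎)) (s≤s (s≤s (s≤s z≤n)))
  where
  open ≤-Reasoning
  double : ∀ nV n → 2 * ((nV + nV) + (n + suc n)) + 2 ≡ 2 * (2 * (nV + suc n))
  double = solve-∀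
  twice : ∀ D → 2 * (D + 4) ≡ D + D + 4 + 4
  twice = solve-∀
  double-euler : 2 * ((nV + nV) + (n + suc n)) + 2 ≡ D + D + 4 + 4
  double-euler = trans (double nV n) (trans (cong (2 *_) euler) (twice D))

module DoubleCover (M : CombMap) (w : Fin (d M) → Bool) (w-α : ∀ x → w (α M x) ≡ w x) where

  Dart : Set
  Dart = Fin (d M) × Bool

  σ̃ α̃ : Dart → Dart
  σ̃ (x , b) = σ M x , b
  α̃ (x , b) = α M x , b xor w x

  σ̃-injective : Injective _≡_ _≡_ σ̃
  σ̃-injective {x , b} {y , c} eq =
    cong₂ _,_ (trans (sym (σ⁻σ M x)) (trans (cong (σ⁻ M ∘ proj₁) eq) (σ⁻σ M y))) (cong proj₂ eq)

  α̃-involutive : ∀ p → α̃ (α̃ p) ≡ p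
  α̃-involutive (x , b) = cong₂ _,_ (α-inv M x) (trans (cong ((b xor w x) xor_) (w-α x)) (xor-cancelʳ b (w x)))

  α̃-fixedPointFree : ∀ p → α̃ p ≢ p
  α̃-fixedPointFree (x , b) eq = α-free M x (cong proj₁ eq)

  open EulerInequality (×Bool-enumeration (d M)) σ̃ σ̃-injective α̃ α̃-involutive α̃-fixedPointFree

  lift : ∀ {x y} (P : Reach M x y) b → Linked (x , b) (y , b xor parity w P)
  lift {x} here b = subst (λ t → Linked (x , b) (x , t)) (sym (xor-identityʳ b)) linked-refl
  lift (stepσ P) b = linked-trans (linked-σ _) (lift P b)
  lift {x} {y} (stepα P) b = linked-trans (linked-α _)
    (subst (λ t → Linked (α M x , b xor w x) (y , t)) (xor-assoc b (w x) (parity w P)) (lift P (b xor w x)))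

  connected-if-parity-differs : (∀ x y → Reach M x y) → ∀ {x₀ z} (P Q : Reach M x₀ z) →
                                parity w P ≢ parity w Q → ∀ p q → Linked p q
  connected-if-parity-differs connected {x₀} {z} P Q P≢Q p q =
    linked-trans (linked-sym (proj₂ (to-base p))) (linked-trans (sheets _ _) (proj₂ (to-base q)))
    where
    to-base : ∀ p → ∃ λ b₀ → Linked (x₀ , b₀) p
    to-base (x , b) = let R = connected x₀ x in
      b xor parity w R , subst (λ t → Linked (x₀ , b xor parity w R) (x , t)) (xor-cancelʳ b (parity w R)) (lift R (b xor parity w R))
    flip : Linked (x₀ , false) (x₀ , true)
    flip = linked-trans (subst (λ t → Linked (x₀ , false) (z , t)) Q≡notP (lift Q false)) (linked-sym (lift P true))
      where
      Q≡notP : parity w Q ≡ not (parity w P)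
      Q≡notP with parity w P | parity w Q
      ... | false | false = ⊥-elim (P≢Q refl)
      ... | false | true  = refl
      ... | true  | false = refl
      ... | true  | true  = ⊥-elim (P≢Q refl)
    sheets : ∀ b b′ → Linked (x₀ , b) (x₀ , b′)
    sheets false false = linked-refl
    sheets false true  = flip
    sheets true  false = linked-sym flip
    sheets true  true  = linked-refl

  module Vertices {nV : ℕ} (hV : HasOrbitCount (σ M) nV) where
    open OrbitCount hV
    open Enumeration (×Bool-enumeration nV)

    iter-σ̃ : ∀ k x b → iter σ̃ k (x , b) ≡ (iter (σ M) k x , b)
    iter-σ̃ zero    x b = refl
    iter-σ̃ (suc k) x b = cong σ̃ (iter-σ̃ k x b)

    vertices≤ : OrbitsAtMost σ̃ (nV + nV)
    vertices≤ = (λ (x , b) → index (label x , b)) , λ (x , b) (y , c) eq →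
      let same = index-injective eq
          (k , σᵏx≡y) = label⇒orbit (cong proj₁ same)
      in k , trans (iter-σ̃ k x b) (cong₂ _,_ σᵏx≡y (cong proj₂ same))

    vertices≥ : OrbitsAtLeast σ̃ (nV + nV)
    vertices≥ = (λ (x , b) → index (label x , b)) , (λ (x , b) → cong (λ u → index (u , b)) (label-π x)) , onto
      where
      onto : ∀ v → ∃ λ p → index (label (proj₁ p) , proj₂ p) ≡ v
      onto v = let (u , b) = element v in
        (representative u , b) , trans (cong (λ u′ → index (u′ , b)) (label-representative u)) (index-element v)

  EvenTriangle : Fin (d M) → Set
  EvenTriangle x = FaceSize M x 3 × (w x xor w (φ M x)) xor w (φ M (φ M x)) ≡ false

  -- parity of w along the boundary walk of a triangular face from r to y
  trianglePath : Fin (d M) → Fin (d M) → Bool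
  trianglePath r y with y F.≟ r
  ... | yes _ = false
  ... | no  _ with y F.≟ φ M r
  ...   | yes _ = w r
  ...   | no  _ = w r xor w (φ M r)

  trianglePath-root : ∀ r → trianglePath r r ≡ false
  trianglePath-root r with r F.≟ r
  ... | yes _   = refl
  ... | no  r≢r = ⊥-elim (r≢r refl)

  trianglePath-next : ∀ r → φ M r ≢ r → trianglePath r (φ M r) ≡ w r
  trianglePath-next r φr≢r with φ M r F.≟ r
  ... | yes φr≡r = ⊥-elim (φr≢r φr≡r)
  ... | no  _ with φ M r F.≟ φ M r
  ...   | yes _     = refl
  ...   | no  φr≢φr = ⊥-elim (φr≢φr refl)

  trianglePath-last : ∀ r y → y ≢ r → y ≢ φ M r → trianglePath r y ≡ w r xor w (φ M r)
  trianglePath-last r y y≢r y≢φr with y F.≟ r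
  ... | yes y≡r = ⊥-elim (y≢r y≡r)
  ... | no  _ with y F.≟ φ M r
  ...   | yes y≡φr = ⊥-elim (y≢φr y≡φr)
  ...   | no  _    = refl

  φ-injective : Injective _≡_ _≡_ (φ M)
  φ-injective {x} {y} eq = trans (sym (α-inv M x)) (trans (cong (α M) α-eq) (α-inv M y))
    where
    α-eq : α M x ≡ α M y
    α-eq = trans (sym (σ⁻σ M (α M x))) (trans (cong (σ⁻ M) eq) (σ⁻σ M (α M y)))

  module Triangle (r : Fin (d M)) (triangle : EvenTriangle r) where

    φ³r≡r : iter (φ M) 3 r ≡ r
    φ³r≡r = proj₁ (proj₁ triangle)

    even : (w r xor w (φ M r)) xor w (φ M (φ M r)) ≡ false
    even = proj₂ triangle

    φr≢r : φ M r ≢ r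
    φr≢r = proj₂ (proj₁ triangle) 1 (s≤s z≤n) (s≤s (s≤s z≤n))

    φ²r≢r : φ M (φ M r) ≢ r
    φ²r≢r = proj₂ (proj₁ triangle) 2 (s≤s z≤n) (s≤s (s≤s (s≤s z≤n)))

    φ²r≢φr : φ M (φ M r) ≢ φ M r
    φ²r≢φr = φr≢r ∘ φ-injective

    on-triangle : ∀ k → let y = iter (φ M) k r in y ≡ r ⊎ y ≡ φ M r ⊎ y ≡ φ M (φ M r)
    on-triangle zero = inj₁ refl
    on-triangle (suc k) with on-triangle k
    ... | inj₁ eq         = inj₂ (inj₁ (cong (φ M) eq))
    ... | inj₂ (inj₁ eq)  = inj₂ (inj₂ (cong (φ M) eq))
    ... | inj₂ (inj₂ eq)  = inj₁ (trans (cong (φ M) eq) φ³r≡r)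

    trianglePath-φ : ∀ {x} → SameFace M r x → trianglePath r (φ M x) ≡ trianglePath r x xor w x
    trianglePath-φ (k , refl) with on-triangle k
    ... | inj₁ eq rewrite eq =
      trans (trianglePath-next r φr≢r) (cong (_xor w r) (sym (trianglePath-root r)))
    ... | inj₂ (inj₁ eq) rewrite eq =
      trans (trianglePath-last r _ φ²r≢r φ²r≢φr) (cong (_xor w (φ M r)) (sym (trianglePath-next r φr≢r)))
    ... | inj₂ (inj₂ eq) rewrite eq = begin
      trianglePath r (φ M (φ M (φ M r)))                ≡⟨ cong (trianglePath r) φ³r≡r ⟩
      trianglePath r r                                  ≡⟨ trianglePath-root r ⟩
      false                                             ≡⟨ sym even ⟩
      (w r xor w (φ M r)) xor w (φ M (φ M r))           ≡⟨ cong (_xor w (φ M (φ M r))) (sym last) ⟩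
      trianglePath r (φ M (φ M r)) xor w (φ M (φ M r))  ∎
      where
      open ≡-Reasoning
      last : trianglePath r (φ M (φ M r)) ≡ w r xor w (φ M r)
      last = trianglePath-last r _ φ²r≢r φ²r≢φr

  module Faces (o : Fin (d M)) {nF : ℕ} (hF : HasOrbitCount (φ M) nF)
               (inner-even : ∀ x → ¬ SameFace M o x → EvenTriangle x) where
    open OrbitCount hF renaming (label to face; label-π to face-φ; representative to root; label-representative to face-root)
    open Enumeration (×Bool-enumeration nF)

    -- a lifted inner face is named by its sheet at the root of the face; the outer face gets a single name
    sheet : ∀ {f} → Dec (f ≡ face o) → Fin (d M) → Bool → Bool
    sheet     (yes _) x b = false
    sheet {f} (no  _) x b = b xor trianglePath (root f) x

    liftedFace : Dart → Fin nF × Bool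
    liftedFace (x , b) = face x , sheet (face x F.≟ face o) x b

    sheet-φ : ∀ x b (inner? : Dec (face x ≡ face o)) → sheet inner? (φ M x) (b xor w x) ≡ sheet inner? x b
    sheet-φ x b (yes _)   = refl
    sheet-φ x b (no  x∉o) = begin
      (b xor w x) xor trianglePath r (φ M x)          ≡⟨ cong ((b xor w x) xor_) (Triangle.trianglePath-φ r (inner-even r r∉o) r→x) ⟩
      (b xor w x) xor (trianglePath r x xor w x)      ≡⟨ xor-cancel-middle b (w x) (trianglePath r x) ⟩
      b xor trianglePath r x                          ∎
      where
      open ≡-Reasoning
      r : Fin (d M)
      r = root (face x)
      r→x : SameFace M r x
      r→x = label⇒orbit (face-root (face x))
      r∉o : ¬ SameFace M o r
      r∉o o→r = x∉o (sym (trans (orbit⇒label o→r) (face-root (face x))))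

    liftedFace-φ̃ : ∀ p → liftedFace (σ̃ (α̃ p)) ≡ liftedFace p
    liftedFace-φ̃ (x , b) =
      trans (cong (λ f → f , sheet (f F.≟ face o) (φ M x) (b xor w x)) (face-φ x))
            (cong (face x ,_) (sheet-φ x b (face x F.≟ face o)))

    liftedFace-outer : liftedFace (o , false) ≡ (face o , false)
    liftedFace-outer = cong (face o ,_) (sheet-outer (face o F.≟ face o))
      where
      sheet-outer : (o? : Dec (face o ≡ face o)) → sheet o? o false ≡ false
      sheet-outer (yes _)  = refl
      sheet-outer (no o≢o) = ⊥-elim (o≢o refl)

    liftedFace-root : ∀ f c → f ≢ face o → liftedFace (root f , c) ≡ (f , c)
    liftedFace-root f c f≢o = cong₂ _,_ (face-root f) (sheet-root (face (root f) F.≟ face o))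
      where
      sheet-root : (inner? : Dec (face (root f) ≡ face o)) → sheet inner? (root f) c ≡ c
      sheet-root (yes f≡o) = ⊥-elim (f≢o (trans (sym (face-root f)) f≡o))
      sheet-root (no  _)   = begin
        c xor trianglePath (root (face (root f))) (root f)   ≡⟨ cong (λ g → c xor trianglePath (root g) (root f)) (face-root f) ⟩
        c xor trianglePath (root f) (root f)                 ≡⟨ cong (c xor_) (trianglePath-root (root f)) ⟩
        c xor false                                          ≡⟨ xor-identityʳ c ⟩
        c                                                    ∎
        where open ≡-Reasoning

    liftedFace-onto : ∀ f c → (f , c) ≢ (face o , true) → ∃ λ p → liftedFace p ≡ (f , c)
    liftedFace-onto f c fc≢ with f F.≟ face o
    liftedFace-onto f false fc≢ | yes refl = (o , false) , liftedFace-outer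
    liftedFace-onto f true  fc≢ | yes refl = ⊥-elim (fc≢ refl)
    liftedFace-onto f c     fc≢ | no  f≢o  = (root f , c) , liftedFace-root f c f≢o

    faces≥ : OrbitsAtLeast (σ̃ ∘ α̃) (pred (nF + nF))
    faces≥ = orbitsAtLeast-punctured (index ∘ liftedFace) (cong index ∘ liftedFace-φ̃)
               (index (face o , false)) (index (face o , true)) (λ eq → false≢true (cong proj₂ (index-injective eq)))
               onto
      where
      false≢true : false ≢ true
      false≢true ()
      onto : ∀ v → v ≢ index (face o , true) → ∃ λ p → index (liftedFace p) ≡ v
      onto v v≢ = let (p , eq) = liftedFace-onto (proj₁ (element v)) (proj₂ (element v))
                                   (λ eq → v≢ (trans (sym (index-element v)) (cong index eq)))
                  in p , trans (cong index eq) (index-element v)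

  parity-path-independent : PlaneSimple M → (o : Fin (d M)) → (∀ x → ¬ SameFace M o x → EvenTriangle x) →
                            ∀ {x₀ z} (P Q : Reach M x₀ z) → parity w P ≡ parity w Q
  parity-path-independent plane o inner-even P Q with parity w P B.≟ parity w Q
  ... | yes same   = same
  ... | no  differ = ⊥-elim (cover-too-small (PlaneSimple.euler plane))
    where
    cover-too-small : ¬ (Σ ℕ λ nV → Σ ℕ λ nF → HasOrbitCount (σ M) nV × HasOrbitCount (φ M) nF × (2 * (nV + nF) ≡ d M + 4))
    cover-too-small (nV , nF , hV , hF , euler) =
      double-cover-too-small nV nF (d M) (OrbitCount.label hF o) euler
        (euler-inequality (connected-if-parity-differs (PlaneSimple.connected plane) P Q differ)
                          (Vertices.vertices≤ hV) (Vertices.vertices≥ hV) (Faces.faces≥ o hF inner-even))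

grand-of-parity : (M : CombMap) (red : Fin (d M) → Bool) (o : Fin (d M)) (walk : ∀ y → Reach M o y) →
                  (∀ {z} (P Q : Reach M o z) → parity (not ∘ red) P ≡ parity (not ∘ red) Q) → Grand M red
grand-of-parity M red o walk independent = part , part-σ , black-edge , red-edge
  where
  part : Fin (d M) → Bool
  part y = parity (not ∘ red) (walk y)

  part-step : ∀ {x y} (step : Reach M x y) → part y ≡ part x xor parity (not ∘ red) step
  part-step {x} step = trans (independent (walk _) (reach-trans (walk x) step)) (parity-trans (not ∘ red) (walk x) step)

  part-σ : ∀ x → part (σ M x) ≡ part x
  part-σ x = trans (part-step (stepσ here)) (xor-identityʳ (part x))

  part-α : ∀ x → part (α M x) ≡ part x xor not (red x)
  part-α x = trans (part-step (stepα here)) (cong (part x xor_) (xor-identityʳ (not (red x))))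

  black-edge : ∀ x → red x ≡ false → part x ≢ part (α M x)
  black-edge x x-black same = not-¬ refl (begin
    part x                   ≡⟨ same ⟩
    part (α M x)             ≡⟨ part-α x ⟩
    part x xor not (red x)   ≡⟨ cong (λ r → part x xor not r) x-black ⟩
    part x xor true          ≡⟨ xor-comm (part x) true ⟩
    not (part x)             ∎)
    where open ≡-Reasoning

  red-edge : ∀ x → red x ≡ true → part x ≡ part (α M x)
  red-edge x x-red = sym (trans (part-α x) (trans (cong (λ r → part x xor not r) x-red) (xor-identityʳ (part x))))

rtiling-grand : (M : CombMap) (red : Fin (d M) → Bool) {Inner : Fin (d M) → Set} →
                PlaneSimple M → RTiling M Inner red → (o : Fin (d M)) →
                (∀ x → ¬ SameFace M o x → Inner x × FaceSize M x 3) → Grand M red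
rtiling-grand M red plane tiling o inner =
  grand-of-parity M red o (PlaneSimple.connected plane o) (parity-path-independent plane o even)
  where
  open DoubleCover M (not ∘ red) (cong not ∘ RTiling.edge-colour tiling)
  even : ∀ x → ¬ SameFace M o x → EvenTriangle x
  even x x∉o = let (x-inner , size) = inner x x∉o in
    size , exactlyOne⇒evenBlack _ _ _ (RTiling.one-red tiling x x-inner)

grand-of-empty : (M : CombMap) (red : Fin (d M) → Bool) → ¬ Fin (d M) → Grand M red
grand-of-empty M red empty = ⊥-elim ∘ empty , ⊥-elim ∘ empty , (λ x → ⊥-elim (empty x)) , (λ x → ⊥-elim (empty x))

inhabited? : ∀ n → Dec (Fin n)
inhabited? zero    = no λ ()
inhabited? (suc n) = yes F.zero

theorem7p9 : (M : CombMap) (red : Fin (d M) → Bool) →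
    (MPG M × RTiling M (λ _ → ⊤) red)
    ⊎ (Σ ℕ λ n → Σ (Fin (d M)) λ o →
         (3 ≤ n) × SemiMPG M n o × RTiling M (λ x → ¬ SameFace M o x) red) →
    Grand M red
theorem7p9 M red (inj₁ (mpg , tiling)) with inhabited? (d M)
... | no  empty = grand-of-empty M red empty
... | yes o     = rtiling-grand M red (MPG.plane mpg) tiling o (λ x _ → tt , MPG.triangles mpg x)
theorem7p9 M red (inj₂ (n , o , _ , semi , tiling)) =
  rtiling-grand M red (SemiMPG.plane semi) tiling o (λ x x∉o → x∉o , SemiMPG.triangles semi x x∉o)
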